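{- Let $H=\mathbb{Z}_3\times\mathbb{Z}_2^{7}$ (one ternary coordinate and seven binary coordinates) with the Hamming distance. Every code $C\subseteq H$ with minimum distance $3$ and maximal cardinality $|C|=N(7,1;3)$ contains two codewords $w,w'$ with $d(w,w')=3$ and $d^b(w,w')=3$.
   Context: The Hamming distance $d(w,x)$ is the number of coordinates in which $w$ and $x$ differ; $d^b(w,x)$ is the number of binary coordinates (those in $\mathbb{Z}_2$) in which they differ, so $d=d^b+d^t$ with $d^t$ counting differing ternary coordinates. The minimum distance of a code is the minimum distance between two distinct codewords. $N(b,t;d)$ denotes the maximum cardinality of a code in $\mathbb{Z}_3^{t}\times\mathbb{Z}_2^{b}$ with minimum distance $d$. -}

module Defs where

open import Data.Nat using (ℕ; zero; suc; _+_; _≥_; _≤_)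
open import Data.Fin using (Fin)
open import Data.Bool using (true; false)
open import Data.Vec using (Vec; []; _∷_)
open import Data.Product using (_×_; _,_; ∃; ∃-syntax; proj₁; proj₂)
open import Data.List using (List; length)
open import Data.List.Membership.Propositional using (_∈_)
open import Data.List.Relation.Unary.Unique.Propositional using (Unique)
open import Relation.Binary.PropositionalEquality using (_≡_)
open import Relation.Nullary using (¬_; does)
open import Data.Fin.Properties using (_≟_)

diffs : ∀ {q n} → Vec (Fin q) n → Vec (Fin q) n → ℕ
diffs [] [] = 0
diffs (x ∷ xs) (y ∷ ys) with does (x ≟ y)
... | true  = diffs xs ys
... | false = suc (diffs xs ys)

Space : ℕ → ℕ → Set
Space t b = Vec (Fin 3) t × Vec (Fin 2) b

dᵇ : ∀ {t b} → Space t b → Space t b → ℕ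
dᵇ w x = diffs (proj₂ w) (proj₂ x)

dᵗ : ∀ {t b} → Space t b → Space t b → ℕ
dᵗ w x = diffs (proj₁ w) (proj₁ x)

d : ∀ {t b} → Space t b → Space t b → ℕ
d w x = dᵇ w x + dᵗ w x

record Code (t b : ℕ) : Set where
  constructor code
  field
    words  : List (Space t b)
    unique : Unique words
open Code public

∣_∣ : ∀ {t b} → Code t b → ℕ
∣ C ∣ = length (words C)

HasMinDist : ∀ {t b} → Code t b → ℕ → Set
HasMinDist C δ =
  (∀ {w x} → w ∈ words C → x ∈ words C → ¬ (w ≡ x) → d w x ≥ δ)
  × ∃[ w ] ∃[ x ] (w ∈ words C × x ∈ words C × ¬ (w ≡ x) × d w x ≡ δ)

IsOptimal : ∀ {t b} → Code t b → ℕ → Set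
IsOptimal {t} {b} C δ = HasMinDist C δ × (∀ (C′ : Code t b) → HasMinDist C′ δ → ∣ C′ ∣ ≤ ∣ C ∣)

-- An optimal code has at least 25 words, witnessed by the explicit code code₂₅.
-- If no two codewords were at distance 3 with all three differences binary,
-- codewords with the same ternary coordinate would be at binary distance at
-- least 4; each of the three fibres over the ternary coordinate is then a binary
-- code of length 7 and minimum distance 4, which has at most 8 words by
-- Plotkin's double count of the pairwise distances: nine such words would give
-- 4 · (9 choose 2) = 144 on one side, but each coordinate, split 4 + 5 at best,
-- contributes at most 20, for a total of at most 140.  So the code would have at
-- most 24 words.
module Submission where

open import Defs
open import Algebra.Properties.CommutativeSemigroup using (interchange)
open import Data.Bool using (true; false)
open import Data.Empty using (⊥-elim)
open import Data.Fin using (Fin; zero; suc)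
import Data.Fin.Properties as Fin
open import Data.List using (List; []; _∷_; length; map; filter; take)
open import Data.List.Membership.Propositional using (_∈_; find; lose)
open import Data.List.Properties using (length-map; length-take; map-cong; map-∘)
open import Data.List.Relation.Unary.All as All using (All; []; _∷_)
open import Data.List.Relation.Unary.All.Properties using (all-filter)
open import Data.List.Relation.Unary.AllPairs using (AllPairs; []; _∷_; allPairs?)
import Data.List.Relation.Unary.AllPairs.Properties as AllPairs
open import Data.List.Relation.Unary.Any using (here; there; any?)
open import Data.List.Relation.Unary.Unique.DecPropositional using (unique?)
open import Data.List.Relation.Unary.Unique.Propositional using (Unique)
open import Data.Nat using (ℕ; zero; suc; _+_; _*_; _∸_; _≤_; _<_; s≤s)
open import Data.Nat.Combinatorics using (nC1≡n; nCk+nC[k+1]≡[n+1]C[k+1]) renaming (_C_ to _choose_)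
open import Data.Nat.ListAction using (sum)
open import Data.Nat.Properties
open import Data.Nat.Solver using (module +-*-Solver)
open import Data.Sum using ([_,_]′)
open import Data.Product using (_×_; _,_; ∃-syntax; proj₁; proj₂)
import Data.Product.Properties as Product
open import Data.Vec using (Vec; []; _∷_; [_]; head; tail)
import Data.Vec.Properties as Vec
open import Function using (_∘_)
open import Level using (Level)
open import Relation.Binary.Definitions using (DecidableEquality)
open import Relation.Binary.PropositionalEquality hiding ([_])
open import Relation.Nullary using (¬_; does; yes; no)
open import Relation.Nullary.Decidable using (toWitness; toWitnessFalse; _×-dec_)

private
  variable
    ℓ : Level
    A : Set ℓ

allPairs-mapWith∈ : ∀ {ℓ₁ ℓ₂} {R : A → A → Set ℓ₁} {S : A → A → Set ℓ₂} {xs : List A} →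
                    (∀ {x y} → x ∈ xs → y ∈ xs → R x y → S x y) → AllPairs R xs → AllPairs S xs
allPairs-mapWith∈ f []         = []
allPairs-mapWith∈ f (Rx ∷ Rxs) =
  All.tabulate (λ y∈ → f (here refl) (there y∈) (All.lookup Rx y∈))
  ∷ allPairs-mapWith∈ (λ x∈ y∈ → f (there x∈) (there y∈)) Rxs

allPairs-lookup : ∀ {ℓ′} {R : A → A → Set ℓ′} → (∀ {x y} → R x y → R y x) →
                  ∀ {xs x y} → AllPairs R xs → x ∈ xs → y ∈ xs → ¬ x ≡ y → R x y
allPairs-lookup sym-R (Rx ∷ Rxs) (here refl) (here refl) x≢y = ⊥-elim (x≢y refl)
allPairs-lookup sym-R (Rx ∷ Rxs) (here refl) (there y∈)  x≢y = All.lookup Rx y∈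
allPairs-lookup sym-R (Rx ∷ Rxs) (there x∈)  (here refl) x≢y = sym-R (All.lookup Rx x∈)
allPairs-lookup sym-R (Rx ∷ Rxs) (there x∈)  (there y∈)  x≢y = allPairs-lookup sym-R Rxs x∈ y∈ x≢y

pairSum : (A → A → ℕ) → List A → ℕ
pairSum f []       = 0
pairSum f (x ∷ xs) = sum (map (f x) xs) + pairSum f xs

sum-map-+ : (f g : A → ℕ) (xs : List A) →
            sum (map (λ x → f x + g x) xs) ≡ sum (map f xs) + sum (map g xs)
sum-map-+ f g []       = refl
sum-map-+ f g (x ∷ xs) = begin
  f x + g x + sum (map (λ x → f x + g x) xs)  ≡⟨ cong (f x + g x +_) (sum-map-+ f g xs) ⟩
  f x + g x + (sum (map f xs) + sum (map g xs)) ≡⟨ interchange +-commutativeSemigroup (f x) (g x) _ _ ⟩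
  f x + sum (map f xs) + (g x + sum (map g xs)) ∎
  where open ≡-Reasoning

sum-map-lower : ∀ {δ} (f : A → ℕ) {xs : List A} → All (λ x → δ ≤ f x) xs →
                δ * length xs ≤ sum (map f xs)
sum-map-lower {δ = δ} f []                      = ≤-reflexive (*-zeroʳ δ)
sum-map-lower {δ = δ} f {x ∷ xs} (δ≤fx ∷ δ≤fxs) = begin
  δ * suc (length xs)     ≡⟨ *-suc δ (length xs) ⟩
  δ + δ * length xs       ≤⟨ +-mono-≤ δ≤fx (sum-map-lower f δ≤fxs) ⟩
  f x + sum (map f xs)    ∎
  where open ≤-Reasoning

sum-map-zero : (f : A → ℕ) → (∀ x → f x ≡ 0) → (xs : List A) → sum (map f xs) ≡ 0
sum-map-zero f f≡0 []       = refl
sum-map-zero f f≡0 (x ∷ xs) = cong₂ _+_ (f≡0 x) (sum-map-zero f f≡0 xs)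

pairSum-zero : (f : A → A → ℕ) → (∀ x y → f x y ≡ 0) → (xs : List A) → pairSum f xs ≡ 0
pairSum-zero f f≡0 []       = refl
pairSum-zero f f≡0 (x ∷ xs) = cong₂ _+_ (sum-map-zero (f x) (f≡0 x) xs) (pairSum-zero f f≡0 xs)

pairSum-cong : {f g : A → A → ℕ} → (∀ x y → f x y ≡ g x y) → (xs : List A) →
               pairSum f xs ≡ pairSum g xs
pairSum-cong f≡g []       = refl
pairSum-cong f≡g (x ∷ xs) = cong₂ _+_ (cong sum (map-cong (f≡g x) xs)) (pairSum-cong f≡g xs)

pairSum-+ : (f g : A → A → ℕ) (xs : List A) →
            pairSum (λ x y → f x y + g x y) xs ≡ pairSum f xs + pairSum g xs
pairSum-+ f g []       = refl
pairSum-+ f g (x ∷ xs) = begin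
  sum (map (λ y → f x y + g x y) xs) + pairSum (λ x y → f x y + g x y) xs
    ≡⟨ cong₂ _+_ (sum-map-+ (f x) (g x) xs) (pairSum-+ f g xs) ⟩
  sum (map (f x) xs) + sum (map (g x) xs) + (pairSum f xs + pairSum g xs)
    ≡⟨ interchange +-commutativeSemigroup (sum (map (f x) xs)) _ (pairSum f xs) _ ⟩
  sum (map (f x) xs) + pairSum f xs + (sum (map (g x) xs) + pairSum g xs) ∎
  where open ≡-Reasoning

pairSum-map : ∀ {ℓ′} {B : Set ℓ′} (f : B → B → ℕ) (h : A → B) (xs : List A) →
              pairSum f (map h xs) ≡ pairSum (λ x y → f (h x) (h y)) xs
pairSum-map f h []       = refl
pairSum-map f h (x ∷ xs) =
  cong₂ _+_ (cong sum (sym (map-∘ xs))) (pairSum-map f h xs)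

choose2-suc : ∀ n → suc n choose 2 ≡ n + n choose 2
choose2-suc n = begin
  suc n choose 2           ≡⟨ nCk+nC[k+1]≡[n+1]C[k+1] n 1 ⟨
  n choose 1 + n choose 2  ≡⟨ cong (_+ n choose 2) (nC1≡n n) ⟩
  n + n choose 2           ∎
  where open ≡-Reasoning

pairSum-lower : ∀ {δ} (f : A → A → ℕ) {xs : List A} →
                AllPairs (λ x y → δ ≤ f x y) xs → δ * (length xs choose 2) ≤ pairSum f xs
pairSum-lower {δ = δ} f []                       = ≤-reflexive (*-zeroʳ δ)
pairSum-lower {δ = δ} f {x ∷ xs} (δ≤fx ∷ δ≤fxs) = begin
  δ * (suc (length xs) choose 2)            ≡⟨ cong (δ *_) (choose2-suc (length xs)) ⟩
  δ * (length xs + length xs choose 2)      ≡⟨ *-distribˡ-+ δ (length xs) _ ⟩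
  δ * length xs + δ * (length xs choose 2)  ≤⟨ +-mono-≤ (sum-map-lower (f x) δ≤fx) (pairSum-lower f δ≤fxs) ⟩
  sum (map (f x) xs) + pairSum f xs         ∎
  where open ≤-Reasoning

differ : ∀ {q} → Fin q → Fin q → ℕ
differ x y = diffs (x ∷ []) (y ∷ [])

diffs-∷ : ∀ {q n} (x y : Fin q) (xs ys : Vec (Fin q) n) →
          diffs (x ∷ xs) (y ∷ ys) ≡ differ x y + diffs xs ys
diffs-∷ x y xs ys with does (x Fin.≟ y)
... | true  = refl
... | false = refl

diffs-refl : ∀ {q n} (xs : Vec (Fin q) n) → diffs xs xs ≡ 0
diffs-refl []       = refl
diffs-refl (x ∷ xs) with x Fin.≟ x
... | yes _   = diffs-refl xs
... | no x≢x = ⊥-elim (x≢x refl)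

pairSum-diffs-columns : ∀ {q n} (L : List (Vec (Fin q) (suc n))) →
  pairSum diffs L ≡ pairSum differ (map head L) + pairSum diffs (map tail L)
pairSum-diffs-columns L = begin
  pairSum diffs L
    ≡⟨ pairSum-cong (λ { (x ∷ xs) (y ∷ ys) → diffs-∷ x y xs ys }) L ⟩
  pairSum (λ u v → differ (head u) (head v) + diffs (tail u) (tail v)) L
    ≡⟨ pairSum-+ _ _ L ⟩
  pairSum (λ u v → differ (head u) (head v)) L + pairSum (λ u v → diffs (tail u) (tail v)) L
    ≡⟨ cong₂ _+_ (pairSum-map differ head L) (pairSum-map diffs tail L) ⟨
  pairSum differ (map head L) + pairSum diffs (map tail L) ∎
  where open ≡-Reasoning

diffs-sym : ∀ {q n} (xs ys : Vec (Fin q) n) → diffs xs ys ≡ diffs ys xs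
diffs-sym []       []       = refl
diffs-sym (x ∷ xs) (y ∷ ys) with x Fin.≟ y | y Fin.≟ x
... | yes _   | yes _   = diffs-sym xs ys
... | no _    | no _    = cong suc (diffs-sym xs ys)
... | yes x≡y | no y≢x = ⊥-elim (y≢x (sym x≡y))
... | no x≢y  | yes y≡x = ⊥-elim (x≢y (sym y≡x))

d-sym : ∀ {t b} (w x : Space t b) → d w x ≡ d x w
d-sym (u , v) (u′ , v′) = cong₂ _+_ (diffs-sym v v′) (diffs-sym u u′)

-- Plotkin's bound for binary codes

zeros ones : List (Fin 2) → ℕ
zeros []           = 0
zeros (zero ∷ bs)  = suc (zeros bs)
zeros (suc _ ∷ bs) = zeros bs
ones []            = 0
ones (zero ∷ bs)   = ones bs
ones (suc _ ∷ bs)  = suc (ones bs)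

zeros+ones≡length : ∀ bs → zeros bs + ones bs ≡ length bs
zeros+ones≡length []              = refl
zeros+ones≡length (zero ∷ bs)     = cong suc (zeros+ones≡length bs)
zeros+ones≡length (suc zero ∷ bs) =
  trans (+-suc (zeros bs) (ones bs)) (cong suc (zeros+ones≡length bs))

sum-differ-zero : ∀ bs → sum (map (differ zero) bs) ≡ ones bs
sum-differ-zero []              = refl
sum-differ-zero (zero ∷ bs)     = sum-differ-zero bs
sum-differ-zero (suc zero ∷ bs) = cong suc (sum-differ-zero bs)

sum-differ-one : ∀ bs → sum (map (differ (suc zero)) bs) ≡ zeros bs
sum-differ-one []              = refl
sum-differ-one (zero ∷ bs)     = cong suc (sum-differ-one bs)
sum-differ-one (suc zero ∷ bs) = sum-differ-one bs

pairSum-differ : ∀ bs → pairSum differ bs ≡ zeros bs * ones bs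
pairSum-differ []              = refl
pairSum-differ (zero ∷ bs)     = cong₂ _+_ (sum-differ-zero bs) (pairSum-differ bs)
pairSum-differ (suc zero ∷ bs) =
  trans (cong₂ _+_ (sum-differ-one bs) (pairSum-differ bs)) (sym (*-suc (zeros bs) (ones bs)))

am-gm : ∀ m n → 4 * (m * n) ≤ (m + n) * (m + n)
am-gm m n = [ ordered , swap ∘ ordered ]′ (≤-total m n)
  where
  open +-*-Solver
  square-expansion : ∀ m k → (m + (m + k)) * (m + (m + k)) ≡ 4 * (m * (m + k)) + k * k
  square-expansion = solve 2 (λ m k → (m :+ (m :+ k)) :* (m :+ (m :+ k))
                                     := con 4 :* (m :* (m :+ k)) :+ k :* k) refl
  ordered : ∀ {m n} → m ≤ n → 4 * (m * n) ≤ (m + n) * (m + n)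
  ordered {m} {n} m≤n = subst (λ n → 4 * (m * n) ≤ (m + n) * (m + n)) (m+[n∸m]≡n m≤n)
    (≤-trans (m≤m+n _ _) (≤-reflexive (sym (square-expansion m (n ∸ m)))))
  swap : 4 * (n * m) ≤ (n + m) * (n + m) → 4 * (m * n) ≤ (m + n) * (m + n)
  swap = subst₂ _≤_ (cong (4 *_) (*-comm n m)) (cong (λ s → s * s) (+-comm n m))

pairSum-differ-upper : ∀ bs → 4 * pairSum differ bs ≤ length bs * length bs
pairSum-differ-upper bs = begin
  4 * pairSum differ bs          ≡⟨ cong (4 *_) (pairSum-differ bs) ⟩
  4 * (zeros bs * ones bs)       ≤⟨ am-gm (zeros bs) (ones bs) ⟩
  (zeros bs + ones bs) * (zeros bs + ones bs)
    ≡⟨ cong (λ m → m * m) (zeros+ones≡length bs) ⟩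
  length bs * length bs          ∎
  where open ≤-Reasoning

pairSum-diffs-upper : ∀ n (L : List (Vec (Fin 2) n)) →
                      4 * pairSum diffs L ≤ n * (length L * length L)
pairSum-diffs-upper zero    L = ≤-reflexive (cong (4 *_) (pairSum-zero diffs (λ { [] [] → refl }) L))
pairSum-diffs-upper (suc n) L = begin
  4 * pairSum diffs L
    ≡⟨ cong (4 *_) (pairSum-diffs-columns L) ⟩
  4 * (pairSum differ (map head L) + pairSum diffs (map tail L))
    ≡⟨ *-distribˡ-+ 4 (pairSum differ (map head L)) _ ⟩
  4 * pairSum differ (map head L) + 4 * pairSum diffs (map tail L)
    ≤⟨ +-mono-≤ (pairSum-differ-upper (map head L)) (pairSum-diffs-upper n (map tail L)) ⟩
  length (map head L) * length (map head L) + n * (length (map tail L) * length (map tail L))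
    ≡⟨ cong₂ (λ l l′ → l * l + n * (l′ * l′)) (length-map head L) (length-map tail L) ⟩
  suc n * (length L * length L) ∎
  where open ≤-Reasoning

plotkin : ∀ {n δ} {L : List (Vec (Fin 2) n)} → AllPairs (λ u v → δ ≤ diffs u v) L →
          4 * (δ * (length L choose 2)) ≤ n * (length L * length L)
plotkin {n} {L = L} far = ≤-trans (*-monoʳ-≤ 4 (pairSum-lower diffs far)) (pairSum-diffs-upper n L)

dist≥4⇒length≤8 : {L : List (Vec (Fin 2) 7)} → AllPairs (λ u v → 4 ≤ diffs u v) L → length L ≤ 8
dist≥4⇒length≤8 {L} far with length L ≤? 8
... | yes length≤8 = length≤8
... | no  length≰8 = ⊥-elim (toWitnessFalse {a? = 4 * (4 * (9 choose 2)) ≤? 7 * (9 * 9)} _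
        (subst (λ m → 4 * (4 * (m choose 2)) ≤ 7 * (m * m)) length-take-9 (plotkin (AllPairs.take⁺ 9 far))))
  where
  length-take-9 : length (take 9 L) ≡ 9
  length-take-9 = trans (length-take 9 L) (m≤n⇒m⊓n≡m (≰⇒> length≰8))

-- Fibres over the ternary coordinates

_≟ᵗ_ : ∀ {t} → DecidableEquality (Vec (Fin 3) t)
_≟ᵗ_ = Vec.≡-dec Fin._≟_

fibre : ∀ {t b} → Vec (Fin 3) t → List (Space t b) → List (Vec (Fin 2) b)
fibre a = map proj₂ ∘ filter (λ w → proj₁ w ≟ᵗ a)

fibre-allPairs : ∀ {t b ℓ} {R : Vec (Fin 2) b → Vec (Fin 2) b → Set ℓ} (a : Vec (Fin 3) t) {W} →
                 AllPairs (λ w x → proj₁ w ≡ proj₁ x → R (proj₂ w) (proj₂ x)) W →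
                 AllPairs R (fibre a W)
fibre-allPairs a {W} sep = AllPairs.map⁺ (allPairs-mapWith∈
  (λ w∈ x∈ Rwx → Rwx (trans (inFibre w∈) (sym (inFibre x∈)))) (AllPairs.filter⁺ _ sep))
  where
  inFibre : ∀ {w} → w ∈ filter (λ w → proj₁ w ≟ᵗ a) W → proj₁ w ≡ a
  inFibre = All.lookup (all-filter (λ w → proj₁ w ≟ᵗ a) W)

T₀ T₁ T₂ : Vec (Fin 3) 1
T₀ = [ zero ]
T₁ = [ suc zero ]
T₂ = [ suc (suc zero) ]

length≡sum-fibres : ∀ {b} (W : List (Space 1 b)) →
  length W ≡ length (fibre T₀ W) + length (fibre T₁ W) + length (fibre T₂ W)
length≡sum-fibres []                             = refl
length≡sum-fibres ((zero ∷ [] , _) ∷ W)           = cong suc (length≡sum-fibres W)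
length≡sum-fibres ((suc zero ∷ [] , _) ∷ W)       =
  trans (cong suc (length≡sum-fibres W))
        (cong (_+ length (fibre T₂ W)) (sym (+-suc (length (fibre T₀ W)) _)))
length≡sum-fibres ((suc (suc zero) ∷ [] , _) ∷ W) =
  trans (cong suc (length≡sum-fibres W)) (sym (+-suc _ _))

-- A code of size 25

O I : Fin 2
O = zero
I = suc zero

words₂₅ : List (Space 1 7)
words₂₅ =
    (T₀ , I ∷ I ∷ O ∷ I ∷ O ∷ O ∷ O ∷ [])
  ∷ (T₀ , O ∷ O ∷ O ∷ I ∷ I ∷ O ∷ O ∷ [])
  ∷ (T₀ , I ∷ O ∷ I ∷ O ∷ I ∷ I ∷ O ∷ [])
  ∷ (T₀ , O ∷ O ∷ I ∷ I ∷ O ∷ O ∷ I ∷ [])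
  ∷ (T₀ , I ∷ I ∷ O ∷ O ∷ I ∷ O ∷ I ∷ [])
  ∷ (T₀ , O ∷ I ∷ I ∷ O ∷ O ∷ I ∷ I ∷ [])
  ∷ (T₀ , I ∷ O ∷ O ∷ I ∷ O ∷ I ∷ I ∷ [])
  ∷ (T₀ , O ∷ O ∷ O ∷ O ∷ I ∷ I ∷ I ∷ [])
  ∷ (T₀ , I ∷ I ∷ I ∷ I ∷ I ∷ I ∷ I ∷ [])
  ∷ (T₁ , O ∷ I ∷ O ∷ O ∷ O ∷ O ∷ O ∷ [])
  ∷ (T₁ , O ∷ O ∷ I ∷ O ∷ I ∷ O ∷ O ∷ [])
  ∷ (T₁ , I ∷ I ∷ I ∷ I ∷ I ∷ O ∷ O ∷ [])
  ∷ (T₁ , I ∷ O ∷ I ∷ I ∷ O ∷ I ∷ O ∷ [])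
  ∷ (T₁ , I ∷ I ∷ O ∷ O ∷ I ∷ I ∷ O ∷ [])
  ∷ (T₁ , I ∷ I ∷ I ∷ O ∷ O ∷ O ∷ I ∷ [])
  ∷ (T₁ , O ∷ I ∷ O ∷ I ∷ O ∷ I ∷ I ∷ [])
  ∷ (T₁ , O ∷ O ∷ I ∷ I ∷ I ∷ I ∷ I ∷ [])
  ∷ (T₂ , I ∷ O ∷ I ∷ O ∷ O ∷ O ∷ O ∷ [])
  ∷ (T₂ , O ∷ I ∷ I ∷ I ∷ O ∷ O ∷ O ∷ [])
  ∷ (T₂ , O ∷ I ∷ I ∷ O ∷ I ∷ I ∷ O ∷ [])
  ∷ (T₂ , I ∷ O ∷ O ∷ I ∷ I ∷ I ∷ O ∷ [])
  ∷ (T₂ , O ∷ O ∷ O ∷ O ∷ O ∷ O ∷ I ∷ [])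
  ∷ (T₂ , O ∷ I ∷ O ∷ I ∷ I ∷ O ∷ I ∷ [])
  ∷ (T₂ , I ∷ O ∷ I ∷ I ∷ I ∷ O ∷ I ∷ [])
  ∷ (T₂ , I ∷ I ∷ O ∷ O ∷ O ∷ I ∷ I ∷ [])
  ∷ []

code₂₅ : Code 1 7
code₂₅ = code words₂₅ (toWitness {a? = unique? (Product.≡-dec _≟ᵗ_ (Vec.≡-dec Fin._≟_)) words₂₅} _)

code₂₅-minDist : HasMinDist code₂₅ 3
code₂₅-minDist =
    allPairs-lookup (λ {w} {x} → subst (3 ≤_) (d-sym w x))
      (toWitness {a? = allPairs? (λ w x → 3 ≤? d w x) words₂₅} _)
  , _ , _ , here refl , there (there (there (there (here refl)))) , (λ ()) , refl

sameTernary⇒δ<dᵇ : ∀ {t b δ} {W : List (Space t b)} →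
  (∀ {w x} → w ∈ W → x ∈ W → ¬ w ≡ x → δ ≤ d w x) →
  (∀ {w x} → w ∈ W → x ∈ W → ¬ (d w x ≡ δ × dᵇ w x ≡ δ)) →
  ∀ {w x} → w ∈ W → x ∈ W → ¬ w ≡ x → proj₁ w ≡ proj₁ x → δ < dᵇ w x
sameTernary⇒δ<dᵇ minDist no-pair {w} {x} w∈ x∈ w≢x sameTernary =
  ≤∧≢⇒< (subst (_ ≤_) d≡dᵇ (minDist w∈ x∈ w≢x))
        (λ δ≡dᵇ → no-pair w∈ x∈ (trans d≡dᵇ (sym δ≡dᵇ) , sym δ≡dᵇ))
  where
  d≡dᵇ : d w x ≡ dᵇ w x
  d≡dᵇ = trans (cong (dᵇ w x +_) (trans (cong (λ a → diffs a (proj₁ x)) sameTernary) (diffs-refl (proj₁ x))))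
               (+-identityʳ (dᵇ w x))

noBinaryPair⇒length≤24 : {W : List (Space 1 7)} → Unique W →
  (∀ {w x} → w ∈ W → x ∈ W → ¬ w ≡ x → 3 ≤ d w x) →
  (∀ {w x} → w ∈ W → x ∈ W → ¬ (d w x ≡ 3 × dᵇ w x ≡ 3)) →
  length W ≤ 24
noBinaryPair⇒length≤24 {W} distinct minDist no-pair = begin
  length W
    ≡⟨ length≡sum-fibres W ⟩
  length (fibre T₀ W) + length (fibre T₁ W) + length (fibre T₂ W)
    ≤⟨ +-mono-≤ (+-mono-≤ (fibre≤8 T₀) (fibre≤8 T₁)) (fibre≤8 T₂) ⟩
  24 ∎
  where
  open ≤-Reasoning
  separated : AllPairs (λ w x → proj₁ w ≡ proj₁ x → 4 ≤ dᵇ w x) W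
  separated = allPairs-mapWith∈ (sameTernary⇒δ<dᵇ minDist no-pair) distinct
  fibre≤8 : ∀ a → length (fibre a W) ≤ 8
  fibre≤8 a = dist≥4⇒length≤8 (fibre-allPairs {R = λ u v → 4 ≤ diffs u v} a separated)

lemma1 : (C : Code 1 7) → IsOptimal C 3 →
    ∃[ w ] ∃[ w′ ] (w ∈ words C × w′ ∈ words C × d w w′ ≡ 3 × dᵇ w w′ ≡ 3)
lemma1 C ((minDist , _) , maximal)
  with any? (λ w → any? (λ w′ → (d w w′ ≟ 3) ×-dec (dᵇ w w′ ≟ 3)) (words C)) (words C)
... | yes found =
  let w , w∈ , found′ = find found
      w′ , w′∈ , d≡3 , dᵇ≡3 = find found′
  in w , w′ , w∈ , w′∈ , d≡3 , dᵇ≡3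
... | no none = ⊥-elim (<⇒≱ (s≤s ∣C∣≤24) (maximal code₂₅ code₂₅-minDist))
  where
  ∣C∣≤24 : ∣ C ∣ ≤ 24
  ∣C∣≤24 = noBinaryPair⇒length≤24 (unique C) minDist (λ w∈ w′∈ eqs → none (lose w∈ (lose w′∈ eqs)))
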